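{- Let $a$ be a real number with $a\ne 0$ and let $n$ be a positive integer. Then $$\sum_{k=1}^n\binom{2n}{2k}3^{2k}E_{2n-2k,a}=\frac{2^{2n+1}}{a}+\frac{4(a-1)}{a^2}-\frac{(3a-2)^2}{a^3}E_{2n,a}.$$
   Context: For a real number $a$, the sequence $\{E_{n,a}\}$ is defined by $E_{0,a}=1$ and $E_{n,a}=-a\sum_{k=1}^{\lfloor n/2\rfloor}\binom{n}{2k}E_{n-2k,a}$ for $n\ge 1$. -}

module Defs where

open import Level using (Level)
open import Algebra.Bundles using (CommutativeRing)
open import Data.Nat as ℕ using (ℕ; zero; suc; ⌊_/2⌋)
open import Data.Nat.Combinatorics using (_C_)
open import Data.List using (List; []; _∷_)

module _ {c ℓ : Level} (R : CommutativeRing c ℓ) where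
  open CommutativeRing R

  ⟦_⟧ : ℕ → Carrier
  ⟦ zero ⟧  = 0#
  ⟦ suc n ⟧ = 1# + ⟦ n ⟧

  _^ᴿ_ : Carrier → ℕ → Carrier
  x ^ᴿ zero  = 1#
  x ^ᴿ suc n = x * (x ^ᴿ n)

  Σ₁ : ℕ → (ℕ → Carrier) → Carrier
  Σ₁ zero    f = 0#
  Σ₁ (suc m) f = Σ₁ m f + f (suc m)

  -- j-th entry of a list (0 if out of range; never out of range below)
  nth : List Carrier → ℕ → Carrier
  nth []       _       = 0#
  nth (x ∷ _)  zero    = x
  nth (_ ∷ xs) (suc j) = nth xs j

  -- history list  [E_n, E_{n-1}, …, E_0]  of the sequence E_{·,a}
  -- E_0 = 1,  E_m = -a Σ_{k=1}^{⌊m/2⌋} C(m,2k) E_{m-2k}   (m ≥ 1)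
  -- For m = n+1, E_{m-2k} is entry number 2k-1 of the history for n.
  Ehist : Carrier → ℕ → List Carrier
  Ehist a zero    = 1# ∷ []
  Ehist a (suc n) =
    (- a * Σ₁ ⌊ suc n /2⌋ (λ k → ⟦ suc n C (2 ℕ.* k) ⟧ * nth (Ehist a n) (2 ℕ.* k ℕ.∸ 1)))
      ∷ Ehist a n

  E : ℕ → Carrier → Carrier
  E n a = nth (Ehist a n) 0

module Submission where

-- The recurrence says that the exponential generating function of E is 1 / (1 - a + a cosh x).
-- With c = cosh x we have cosh 3x = 4c³ - 3c, and dividing 4c³ - 3c by 1 - a + a c leaves a
-- polynomial in c plus a multiple of 1 / (1 - a + a c); comparing coefficients of x²ⁿ/(2n)! gives
-- the identity. We work with coefficient sequences, so products of generating functions become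
-- binomial convolutions, and the only facts about cosh used are the product formulas
-- 2 cosh(sx) cosh(tx) = cosh((s+t)x) + cosh((s-t)x). Since 2 need not be invertible in R nothing is
-- ever halved; only a is inverted, once, at the very end.

open import Level using (Level; 0ℓ)
open import Algebra.Bundles using (CommutativeRing; RawRing)
import Algebra.Solver.Ring.AlmostCommutativeRing as Solver
open import Data.Maybe using (Maybe; just; nothing)
open import Data.Nat as ℕ using (ℕ; zero; suc; _≤_; z≤n; s≤s; ⌊_/2⌋)
import Data.Nat.Properties as ℕₚ
open import Data.Nat.Combinatorics using (_C_; k>n⇒nCk≡0; nCk+nC[k+1]≡[n+1]C[k+1])
open import Data.Product using (_×_; _,_; proj₁)
open import Relation.Binary.PropositionalEquality as ≡ using (_≡_)
open import Relation.Nullary using (yes; no)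

open import Defs

⌊2*n/2⌋≡n : ∀ n → ⌊ 2 ℕ.* n /2⌋ ≡ n
⌊2*n/2⌋≡n zero = ≡.refl
⌊2*n/2⌋≡n (suc n) rewrite ℕₚ.*-suc 2 n = ≡.cong suc (⌊2*n/2⌋≡n n)

k≤⌊n/2⌋⇒2*k≤n : ∀ {n k} → k ≤ ⌊ n /2⌋ → 2 ℕ.* k ≤ n
k≤⌊n/2⌋⇒2*k≤n {k = zero} _ = z≤n
k≤⌊n/2⌋⇒2*k≤n {suc (suc n)} {suc k} (s≤s k≤n/2) rewrite ℕₚ.*-suc 2 k = s≤s (s≤s (k≤⌊n/2⌋⇒2*k≤n k≤n/2))

module InCommutativeRing {r₁ r₂ : Level} (R : CommutativeRing r₁ r₂) where
  open CommutativeRing R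
  open import Relation.Binary.Reasoning.Setoid setoid
  open import Algebra.Properties.Ring ring using (-0#≈0#; -‿distribˡ-*; x[y-z]≈xy-xz; [y-z]x≈yx-zx)
  open import Algebra.Properties.Group +-group using (x∙y⁻¹≈ε⇒x≈y; x≈y⇒x∙y⁻¹≈ε)
  open import Algebra.Properties.AbelianGroup +-abelianGroup using (⁻¹-∙-comm; ⁻¹-anti-homo‿-)
  open import Algebra.Properties.CommutativeSemigroup +-commutativeSemigroup using (interchange)
  open import Algebra.Properties.Semiring.Mult semiring as Mult using (×-homo-+; ×1-homo-*)

  infixr 9 _^_
  _^_ : Carrier → ℕ → Carrier
  _^_ = _^ᴿ_ R

  ι : ℕ → Carrier
  ι = ⟦_⟧ R

  ι≈×1# : ∀ n → ι n ≈ n Mult.× 1#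
  ι≈×1# zero    = refl
  ι≈×1# (suc n) = +-congˡ (ι≈×1# n)

  ι-homo-+ : ∀ m n → ι (m ℕ.+ n) ≈ ι m + ι n
  ι-homo-+ m n = begin
    ι (m ℕ.+ n)                   ≈⟨ ι≈×1# (m ℕ.+ n) ⟩
    (m ℕ.+ n) Mult.× 1#           ≈⟨ ×-homo-+ 1# m n ⟩
    m Mult.× 1# + n Mult.× 1#     ≈⟨ +-cong (ι≈×1# m) (ι≈×1# n) ⟨
    ι m + ι n                     ∎

  ι-homo-* : ∀ m n → ι (m ℕ.* n) ≈ ι m * ι n
  ι-homo-* m n = begin
    ι (m ℕ.* n)                   ≈⟨ ι≈×1# (m ℕ.* n) ⟩
    (m ℕ.* n) Mult.× 1#           ≈⟨ ×1-homo-* m n ⟩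
    m Mult.× 1# * n Mult.× 1#     ≈⟨ *-cong (ι≈×1# m) (ι≈×1# n) ⟨
    ι m * ι n                     ∎

  ι-homo-^ : ∀ m n → ι (m ℕ.^ n) ≈ ι m ^ n
  ι-homo-^ m zero    = +-identityʳ 1#
  ι-homo-^ m (suc n) = trans (ι-homo-* m (m ℕ.^ n)) (*-congˡ (ι-homo-^ m n))

  1#^n≈1# : ∀ n → 1# ^ n ≈ 1#
  1#^n≈1# zero    = refl
  1#^n≈1# (suc n) = trans (*-identityˡ _) (1#^n≈1# n)

  [x+y]-[z+w]≈[x-z]+[y-w] : ∀ x y z w → (x + y) - (z + w) ≈ (x - z) + (y - w)
  [x+y]-[z+w]≈[x-z]+[y-w] x y z w = trans (+-congˡ (sym (⁻¹-∙-comm z w))) (interchange x y (- z) (- w))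

  [x-y][z-w]≈[xz+yw]-[xw+yz] : ∀ x y z w → (x - y) * (z - w) ≈ (x * z + y * w) - (x * w + y * z)
  [x-y][z-w]≈[xz+yw]-[xw+yz] x y z w = begin
    (x - y) * (z - w)                    ≈⟨ [y-z]x≈yx-zx (z - w) x y ⟩
    x * (z - w) - y * (z - w)            ≈⟨ +-cong (x[y-z]≈xy-xz x z w) (-‿cong (x[y-z]≈xy-xz y z w)) ⟩
    (x * z - x * w) - (y * z - y * w)    ≈⟨ +-congˡ (⁻¹-anti-homo‿- (y * z) (y * w)) ⟩
    (x * z - x * w) + (y * w - y * z)    ≈⟨ [x+y]-[z+w]≈[x-z]+[y-w] (x * z) (y * w) (x * w) (y * z) ⟨
    (x * z + y * w) - (x * w + y * z)    ∎

  module IntegerCoefficients where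
    -- Pairs (p , q) stand for p - q and are kept normalised (one component zero), because solve
    -- compares coefficients syntactically. The numeral 1 is sent to 1# rather than ι 1 = 1# + 0#, so
    -- that the constant 1 in a solved equation is 1# itself.
    numeral : ℕ → Carrier
    numeral (suc zero) = 1#
    numeral n          = ι n

    numeral≈ι : ∀ n → numeral n ≈ ι n
    numeral≈ι zero          = refl
    numeral≈ι (suc zero)    = sym (+-identityʳ 1#)
    numeral≈ι (suc (suc n)) = refl

    ⟦_⟧ᶻ : ℕ × ℕ → Carrier
    ⟦ p     , zero  ⟧ᶻ = numeral p
    ⟦ zero  , suc q ⟧ᶻ = - numeral (suc q)
    ⟦ suc p , suc q ⟧ᶻ = numeral (suc p) - numeral (suc q)

    ⟦p,q⟧ᶻ≈ιp-ιq : ∀ p q → ⟦ p , q ⟧ᶻ ≈ ι p - ι q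
    ⟦p,q⟧ᶻ≈ιp-ιq p       zero    = trans (numeral≈ι p) (sym (trans (+-congˡ -0#≈0#) (+-identityʳ _)))
    ⟦p,q⟧ᶻ≈ιp-ιq zero    (suc q) = trans (-‿cong (numeral≈ι (suc q))) (sym (+-identityˡ _))
    ⟦p,q⟧ᶻ≈ιp-ιq (suc p) (suc q) = +-cong (numeral≈ι (suc p)) (-‿cong (numeral≈ι (suc q)))

    normalise : ℕ → ℕ → ℕ × ℕ
    normalise p q = p ℕ.∸ q , q ℕ.∸ p

    ι[p∸q]-ι[q∸p]≈ιp-ιq : ∀ p q → ι (p ℕ.∸ q) - ι (q ℕ.∸ p) ≈ ι p - ι q
    ι[p∸q]-ι[q∸p]≈ιp-ιq zero    zero    = refl
    ι[p∸q]-ι[q∸p]≈ιp-ιq zero    (suc q) = refl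
    ι[p∸q]-ι[q∸p]≈ιp-ιq (suc p) zero    = refl
    ι[p∸q]-ι[q∸p]≈ιp-ιq (suc p) (suc q) = begin
      ι (p ℕ.∸ q) - ι (q ℕ.∸ p)    ≈⟨ ι[p∸q]-ι[q∸p]≈ιp-ιq p q ⟩
      ι p - ι q                    ≈⟨ +-identityˡ _ ⟨
      0# + (ι p - ι q)             ≈⟨ +-congʳ (-‿inverseʳ 1#) ⟨
      (1# - 1#) + (ι p - ι q)      ≈⟨ [x+y]-[z+w]≈[x-z]+[y-w] 1# (ι p) 1# (ι q) ⟨
      ι (suc p) - ι (suc q)        ∎

    ⟦normalise⟧ : ∀ p q → ⟦ normalise p q ⟧ᶻ ≈ ι p - ι q
    ⟦normalise⟧ p q = trans (⟦p,q⟧ᶻ≈ιp-ιq (p ℕ.∸ q) (q ℕ.∸ p)) (ι[p∸q]-ι[q∸p]≈ιp-ιq p q)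

    differences : RawRing 0ℓ 0ℓ
    differences = record
      { Carrier = ℕ × ℕ
      ; _≈_     = _≡_
      ; _+_     = λ { (p , q) (r , s) → normalise (p ℕ.+ r) (q ℕ.+ s) }
      ; _*_     = λ { (p , q) (r , s) → normalise (p ℕ.* r ℕ.+ q ℕ.* s) (p ℕ.* s ℕ.+ q ℕ.* r) }
      ; -_      = λ { (p , q) → q , p }
      ; 0#      = 0 , 0
      ; 1#      = 1 , 0
      }

    homomorphism : differences Solver.-Raw-AlmostCommutative⟶ Solver.fromCommutativeRing R
    homomorphism = record
      { ⟦_⟧    = ⟦_⟧ᶻ
      ; +-homo = λ { (p , q) (r , s) → begin
          ⟦ normalise (p ℕ.+ r) (q ℕ.+ s) ⟧ᶻ  ≈⟨ ⟦normalise⟧ (p ℕ.+ r) (q ℕ.+ s) ⟩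
          ι (p ℕ.+ r) - ι (q ℕ.+ s)          ≈⟨ +-cong (ι-homo-+ p r) (-‿cong (ι-homo-+ q s)) ⟩
          (ι p + ι r) - (ι q + ι s)          ≈⟨ [x+y]-[z+w]≈[x-z]+[y-w] (ι p) (ι r) (ι q) (ι s) ⟩
          (ι p - ι q) + (ι r - ι s)          ≈⟨ +-cong (⟦p,q⟧ᶻ≈ιp-ιq p q) (⟦p,q⟧ᶻ≈ιp-ιq r s) ⟨
          ⟦ p , q ⟧ᶻ + ⟦ r , s ⟧ᶻ             ∎ }
      ; *-homo = λ { (p , q) (r , s) → begin
          ⟦ normalise (p ℕ.* r ℕ.+ q ℕ.* s) (p ℕ.* s ℕ.+ q ℕ.* r) ⟧ᶻ
            ≈⟨ ⟦normalise⟧ (p ℕ.* r ℕ.+ q ℕ.* s) (p ℕ.* s ℕ.+ q ℕ.* r) ⟩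
          ι (p ℕ.* r ℕ.+ q ℕ.* s) - ι (p ℕ.* s ℕ.+ q ℕ.* r)
            ≈⟨ +-cong (trans (ι-homo-+ (p ℕ.* r) (q ℕ.* s)) (+-cong (ι-homo-* p r) (ι-homo-* q s)))
                      (-‿cong (trans (ι-homo-+ (p ℕ.* s) (q ℕ.* r)) (+-cong (ι-homo-* p s) (ι-homo-* q r)))) ⟩
          (ι p * ι r + ι q * ι s) - (ι p * ι s + ι q * ι r)
            ≈⟨ [x-y][z-w]≈[xz+yw]-[xw+yz] (ι p) (ι q) (ι r) (ι s) ⟨
          (ι p - ι q) * (ι r - ι s)
            ≈⟨ *-cong (⟦p,q⟧ᶻ≈ιp-ιq p q) (⟦p,q⟧ᶻ≈ιp-ιq r s) ⟨
          ⟦ p , q ⟧ᶻ * ⟦ r , s ⟧ᶻ ∎ }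
      ; -‿homo = λ { (p , q) → begin
          ⟦ q , p ⟧ᶻ    ≈⟨ ⟦p,q⟧ᶻ≈ιp-ιq q p ⟩
          ι q - ι p     ≈⟨ ⁻¹-anti-homo‿- (ι p) (ι q) ⟨
          - (ι p - ι q) ≈⟨ -‿cong (⟦p,q⟧ᶻ≈ιp-ιq p q) ⟨
          - ⟦ p , q ⟧ᶻ  ∎ }
      ; 0-homo = refl
      ; 1-homo = refl
      }

    _≟ᶻ_ : ∀ x y → Maybe (⟦ x ⟧ᶻ ≈ ⟦ y ⟧ᶻ)
    (p , q) ≟ᶻ (r , s) with p ℕ.≟ r | q ℕ.≟ s
    ... | yes ≡.refl | yes ≡.refl = just refl
    ... | _          | _          = nothing

    open import Algebra.Solver.Ring differences (Solver.fromCommutativeRing R) homomorphism _≟ᶻ_ public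
      using (Polynomial; solve; _:=_; con; _:+_; _:*_; _:-_; :-_; _:^_)

  open IntegerCoefficients using (Polynomial; solve; _:=_; con; _:+_; _:*_; _:-_; :-_; _:^_)

  private
    κ : ∀ {n} → ℕ → Polynomial n
    κ k = con (k , 0)

  difference≈0 : ∀ λ′ {l r} → l ≈ r → λ′ * (l - r) ≈ 0#
  difference≈0 λ′ l≈r = trans (*-congˡ (x≈y⇒x∙y⁻¹≈ε l≈r)) (zeroʳ λ′)

  infixl 6 _+-zeros_
  _+-zeros_ : ∀ {x y} → x ≈ 0# → y ≈ 0# → x + y ≈ 0#
  x≈0 +-zeros y≈0 = trans (+-cong x≈0 y≈0) (+-identityʳ 0#)

  Sequence : Set r₁
  Sequence = ℕ → Carrier

  Σ₀ : ℕ → Sequence → Carrier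
  Σ₀ n f = f 0 + Σ₁ R n f

  Σ₁-cong : ∀ n {f g : Sequence} → (∀ {k} → k ℕ.< n → f (suc k) ≈ g (suc k)) → Σ₁ R n f ≈ Σ₁ R n g
  Σ₁-cong zero    f≈g = refl
  Σ₁-cong (suc n) f≈g = +-cong (Σ₁-cong n (λ k<n → f≈g (ℕₚ.m<n⇒m<1+n k<n))) (f≈g ℕₚ.≤-refl)

  Σ₀-cong : ∀ n {f g : Sequence} → (∀ {k} → k ≤ n → f k ≈ g k) → Σ₀ n f ≈ Σ₀ n g
  Σ₀-cong n f≈g = +-cong (f≈g z≤n) (Σ₁-cong n f≈g)

  Σ₁-shift : ∀ n (f : Sequence) → Σ₁ R (suc n) f ≈ Σ₀ n (λ k → f (suc k))
  Σ₁-shift zero    f = +-comm 0# (f 1)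
  Σ₁-shift (suc n) f = trans (+-congʳ (Σ₁-shift n f)) (+-assoc _ _ _)

  Σ₀-suc : ∀ n (f : Sequence) → Σ₀ (suc n) f ≈ f 0 + Σ₀ n (λ k → f (suc k))
  Σ₀-suc n f = +-congˡ (Σ₁-shift n f)

  Σ₁-distrib-+ : ∀ n (f g : Sequence) → Σ₁ R n (λ k → f k + g k) ≈ Σ₁ R n f + Σ₁ R n g
  Σ₁-distrib-+ zero    f g = sym (+-identityʳ 0#)
  Σ₁-distrib-+ (suc n) f g = trans (+-congʳ (Σ₁-distrib-+ n f g)) (interchange _ _ _ _)

  Σ₀-distrib-+ : ∀ n (f g : Sequence) → Σ₀ n (λ k → f k + g k) ≈ Σ₀ n f + Σ₀ n g
  Σ₀-distrib-+ n f g = trans (+-congˡ (Σ₁-distrib-+ n f g)) (interchange _ _ _ _)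

  at-2*suc : ∀ (u : Sequence) k → u (2 ℕ.* suc k) ≈ u (suc (suc (2 ℕ.* k)))
  at-2*suc u k = reflexive (≡.cong u (ℕₚ.*-suc 2 k))

  Σ₀-evens : ∀ n (u : Sequence) → (∀ k → u (suc (2 ℕ.* k)) ≈ 0#) →
             Σ₀ n u ≈ Σ₀ ⌊ n /2⌋ (λ k → u (2 ℕ.* k))
  Σ₀-evens zero          u odd = refl
  Σ₀-evens (suc zero)    u odd = +-congˡ (trans (+-identityˡ (u 1)) (odd 0))
  Σ₀-evens (suc (suc n)) u odd = begin
    Σ₀ (suc (suc n)) u                                        ≈⟨ Σ₀-suc (suc n) u ⟩
    u 0 + Σ₀ (suc n) (λ k → u (suc k))                        ≈⟨ +-congˡ (Σ₀-suc n (λ k → u (suc k))) ⟩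
    u 0 + (u 1 + Σ₀ n u₂)                                     ≈⟨ +-congˡ (trans (+-congʳ (odd 0)) (+-identityˡ _)) ⟩
    u 0 + Σ₀ n u₂                                             ≈⟨ +-congˡ (Σ₀-evens n u₂ odd₂) ⟩
    u 0 + Σ₀ ⌊ n /2⌋ (λ k → u₂ (2 ℕ.* k))                     ≈⟨ +-congˡ (Σ₀-cong ⌊ n /2⌋ (λ {k} _ → sym (at-2*suc u k))) ⟩
    u 0 + Σ₀ ⌊ n /2⌋ (λ k → u (2 ℕ.* suc k))                  ≈⟨ Σ₀-suc ⌊ n /2⌋ (λ k → u (2 ℕ.* k)) ⟨
    Σ₀ (suc ⌊ n /2⌋) (λ k → u (2 ℕ.* k))                      ∎
    where
    u₂ : Sequence
    u₂ k = u (suc (suc k))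
    odd₂ : ∀ k → u₂ (suc (2 ℕ.* k)) ≈ 0#
    odd₂ k = trans (sym (at-2*suc (λ j → u (suc j)) k)) (odd (suc k))

  -- Binomial convolution, i.e. the coefficient sequence of a product of exponential
  -- generating functions, defined through the Leibniz rule (f g)′ = f′ g + f g′.
  infixl 7 _⋆_
  _⋆_ : Sequence → Sequence → Sequence
  (f ⋆ g) zero    = f 0 * g 0
  (f ⋆ g) (suc n) = ((λ k → f (suc k)) ⋆ g) n + (f ⋆ (λ k → g (suc k))) n

  δ : Sequence
  δ zero    = 1#
  δ (suc n) = 0#

  ⋆-cong : ∀ {f f′ g g′ : Sequence} → (∀ k → f k ≈ f′ k) → (∀ k → g k ≈ g′ k) →
           ∀ n → (f ⋆ g) n ≈ (f′ ⋆ g′) n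
  ⋆-cong f≈ g≈ zero    = *-cong (f≈ 0) (g≈ 0)
  ⋆-cong f≈ g≈ (suc n) = +-cong (⋆-cong (λ k → f≈ (suc k)) g≈ n) (⋆-cong f≈ (λ k → g≈ (suc k)) n)

  ⋆-comm : ∀ (f g : Sequence) n → (f ⋆ g) n ≈ (g ⋆ f) n
  ⋆-comm f g zero    = *-comm (f 0) (g 0)
  ⋆-comm f g (suc n) = trans (+-cong (⋆-comm _ g n) (⋆-comm f _ n)) (+-comm _ _)

  ⋆-distribʳ : ∀ (f g h : Sequence) n → ((λ k → f k + g k) ⋆ h) n ≈ (f ⋆ h) n + (g ⋆ h) n
  ⋆-distribʳ f g h zero    = distribʳ (h 0) (f 0) (g 0)
  ⋆-distribʳ f g h (suc n) =
    trans (+-cong (⋆-distribʳ _ _ h n) (⋆-distribʳ f g _ n)) (interchange _ _ _ _)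

  ⋆-distribˡ : ∀ (f g h : Sequence) n → (f ⋆ (λ k → g k + h k)) n ≈ (f ⋆ g) n + (f ⋆ h) n
  ⋆-distribˡ f g h n =
    trans (⋆-comm f _ n) (trans (⋆-distribʳ g h f n) (+-cong (⋆-comm g f n) (⋆-comm h f n)))

  ⋆-scalarˡ : ∀ x (f g : Sequence) n → ((λ k → x * f k) ⋆ g) n ≈ x * (f ⋆ g) n
  ⋆-scalarˡ x f g zero    = *-assoc x (f 0) (g 0)
  ⋆-scalarˡ x f g (suc n) =
    trans (+-cong (⋆-scalarˡ x _ g n) (⋆-scalarˡ x f _ n)) (sym (distribˡ x _ _))

  ⋆-scalarʳ : ∀ x (f g : Sequence) n → (f ⋆ (λ k → x * g k)) n ≈ x * (f ⋆ g) n
  ⋆-scalarʳ x f g n = trans (⋆-comm f _ n) (trans (⋆-scalarˡ x g f n) (*-congˡ (⋆-comm g f n)))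

  ⋆-zeroˡ : ∀ (g : Sequence) n → ((λ _ → 0#) ⋆ g) n ≈ 0#
  ⋆-zeroˡ g zero    = zeroˡ (g 0)
  ⋆-zeroˡ g (suc n) = trans (+-cong (⋆-zeroˡ g n) (⋆-zeroˡ _ n)) (+-identityʳ 0#)

  ⋆-identityˡ : ∀ (g : Sequence) n → (δ ⋆ g) n ≈ g n
  ⋆-identityˡ g zero    = *-identityˡ (g 0)
  ⋆-identityˡ g (suc n) = trans (+-cong (⋆-zeroˡ g n) (⋆-identityˡ _ n)) (+-identityˡ _)

  ⋆-identityʳ : ∀ (f : Sequence) n → (f ⋆ δ) n ≈ f n
  ⋆-identityʳ f n = trans (⋆-comm f δ n) (⋆-identityˡ f n)

  ⋆-assoc : ∀ (f g h : Sequence) n → ((f ⋆ g) ⋆ h) n ≈ (f ⋆ (g ⋆ h)) n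
  ⋆-assoc f g h zero    = *-assoc (f 0) (g 0) (h 0)
  ⋆-assoc f g h (suc n) = begin
    ((λ k → (f′ ⋆ g) k + (f ⋆ g′) k) ⋆ h) n + ((f ⋆ g) ⋆ h′) n
      ≈⟨ +-congʳ (⋆-distribʳ (f′ ⋆ g) (f ⋆ g′) h n) ⟩
    (((f′ ⋆ g) ⋆ h) n + ((f ⋆ g′) ⋆ h) n) + ((f ⋆ g) ⋆ h′) n
      ≈⟨ +-cong (+-cong (⋆-assoc f′ g h n) (⋆-assoc f g′ h n)) (⋆-assoc f g h′ n) ⟩
    ((f′ ⋆ (g ⋆ h)) n + (f ⋆ (g′ ⋆ h)) n) + (f ⋆ (g ⋆ h′)) n
      ≈⟨ +-assoc _ _ _ ⟩
    (f′ ⋆ (g ⋆ h)) n + ((f ⋆ (g′ ⋆ h)) n + (f ⋆ (g ⋆ h′)) n)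
      ≈⟨ +-congˡ (⋆-distribˡ f (g′ ⋆ h) (g ⋆ h′) n) ⟨
    (f′ ⋆ (g ⋆ h)) n + (f ⋆ (λ k → (g′ ⋆ h) k + (g ⋆ h′) k)) n
      ∎
    where
    f′ g′ h′ : Sequence
    f′ k = f (suc k)
    g′ k = g (suc k)
    h′ k = h (suc k)

  ⋆-binomial : ∀ (f g : Sequence) n → (f ⋆ g) n ≈ Σ₀ n (λ j → ι (n C j) * (f j * g (n ℕ.∸ j)))
  ⋆-binomial f g zero    = sym (trans (+-identityʳ _) (trans (*-congʳ (+-identityʳ 1#)) (*-identityˡ _)))
  ⋆-binomial f g (suc n) = begin
    ((λ k → f (suc k)) ⋆ g) n + (f ⋆ (λ k → g (suc k))) n
      ≈⟨ +-cong (⋆-binomial _ g n) (⋆-binomial f _ n) ⟩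
    Σ₀ n A + (h 0 + Σ₁ R n B)            ≈⟨ +-congˡ (+-congˡ (Σ₁-cong n B≈B′)) ⟩
    Σ₀ n A + (h 0 + Σ₁ R n B′)           ≈⟨ rearrange (h 0) (Σ₀ n A) (Σ₁ R n B′) ⟩
    h 0 + (Σ₀ n A + (Σ₁ R n B′ + 0#))    ≈⟨ +-congˡ (+-congˡ (+-congˡ B′-last)) ⟨
    h 0 + (Σ₀ n A + Σ₁ R (suc n) B′)     ≈⟨ +-congˡ (+-congˡ (Σ₁-shift n B′)) ⟩
    h 0 + (Σ₀ n A + Σ₀ n (λ j → B′ (suc j)))
      ≈⟨ +-congˡ (Σ₀-distrib-+ n A _) ⟨
    h 0 + Σ₀ n (λ j → A j + B′ (suc j)) ≈⟨ +-congˡ (Σ₀-cong n (λ {j} _ → pascal-split j)) ⟨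
    h 0 + Σ₀ n (λ j → h (suc j))         ≈⟨ Σ₀-suc n h ⟨
    Σ₀ (suc n) h                         ∎
    where
    h A B B′ : Sequence
    h  j = ι (suc n C j) * (f j * g (suc n ℕ.∸ j))
    A  j = ι (n C j) * (f (suc j) * g (n ℕ.∸ j))
    B  j = ι (n C j) * (f j * g (suc (n ℕ.∸ j)))
    B′ j = ι (n C j) * (f j * g (suc n ℕ.∸ j))

    B≈B′ : ∀ {k} → k ℕ.< n → B (suc k) ≈ B′ (suc k)
    B≈B′ {k} k<n = reflexive (≡.cong (λ i → ι (n C suc k) * (f (suc k) * g i)) (≡.sym (ℕₚ.+-∸-assoc 1 k<n)))

    B′-last : B′ (suc n) ≈ 0#
    B′-last = trans (*-congʳ (reflexive (≡.cong ι (k>n⇒nCk≡0 (ℕₚ.n<1+n n))))) (zeroˡ _)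

    pascal-split : ∀ j → h (suc j) ≈ A j + B′ (suc j)
    pascal-split j = trans (*-congʳ (trans (reflexive (≡.cong ι (≡.sym (nCk+nC[k+1]≡[n+1]C[k+1] n j))))
                                           (ι-homo-+ (n C j) (n C suc j))))
                           (distribʳ _ _ _)

    rearrange : ∀ x y z → y + (x + z) ≈ x + (y + (z + 0#))
    rearrange = solve 3 (λ x y z → y :+ (x :+ z) := x :+ (y :+ (z :+ κ 0))) refl

  -- Exponential generating coefficients of cosh (t x) and sinh (t x).
  mutual
    cosh : Carrier → Sequence
    cosh t zero    = 1#
    cosh t (suc n) = t * sinh t n

    sinh : Carrier → Sequence
    sinh t zero    = 0#
    sinh t (suc n) = t * cosh t n

  mutual
    cosh-cong : ∀ {s t} → s ≈ t → ∀ n → cosh s n ≈ cosh t n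
    cosh-cong s≈t zero    = refl
    cosh-cong s≈t (suc n) = *-cong s≈t (sinh-cong s≈t n)

    sinh-cong : ∀ {s t} → s ≈ t → ∀ n → sinh s n ≈ sinh t n
    sinh-cong s≈t zero    = refl
    sinh-cong s≈t (suc n) = *-cong s≈t (cosh-cong s≈t n)

  sinh-even : ∀ t k → sinh t (2 ℕ.* k) ≈ 0#
  sinh-even t zero    = refl
  sinh-even t (suc k) =
    trans (at-2*suc (sinh t) k) (trans (*-congˡ (*-congˡ (sinh-even t k))) (trans (*-congˡ (zeroʳ t)) (zeroʳ t)))

  cosh-odd : ∀ t k → cosh t (suc (2 ℕ.* k)) ≈ 0#
  cosh-odd t k = trans (*-congˡ (sinh-even t k)) (zeroʳ t)

  cosh-even : ∀ t k → cosh t (2 ℕ.* k) ≈ t ^ (2 ℕ.* k)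
  cosh-even t zero    = refl
  cosh-even t (suc k) =
    trans (at-2*suc (cosh t) k) (trans (*-congˡ (*-congˡ (cosh-even t k))) (sym (at-2*suc (t ^_) k)))

  cosh-0# : ∀ n → cosh 0# n ≈ δ n
  cosh-0# zero    = refl
  cosh-0# (suc n) = zeroˡ _

  cosh-⋆ : ∀ t (f : Sequence) n →
           (cosh t ⋆ f) n ≈ Σ₀ ⌊ n /2⌋ (λ k → ι (n C (2 ℕ.* k)) * (t ^ (2 ℕ.* k) * f (n ℕ.∸ 2 ℕ.* k)))
  cosh-⋆ t f n = begin
    (cosh t ⋆ f) n                                                        ≈⟨ ⋆-binomial (cosh t) f n ⟩
    Σ₀ n (λ j → ι (n C j) * (cosh t j * f (n ℕ.∸ j)))                      ≈⟨ Σ₀-evens n _ odd-terms ⟩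
    Σ₀ ⌊ n /2⌋ (λ k → ι (n C (2 ℕ.* k)) * (cosh t (2 ℕ.* k) * f (n ℕ.∸ 2 ℕ.* k)))
      ≈⟨ Σ₀-cong ⌊ n /2⌋ (λ {k} _ → *-congˡ (*-congʳ (cosh-even t k))) ⟩
    Σ₀ ⌊ n /2⌋ (λ k → ι (n C (2 ℕ.* k)) * (t ^ (2 ℕ.* k) * f (n ℕ.∸ 2 ℕ.* k))) ∎
    where
    odd-terms : ∀ k → ι (n C suc (2 ℕ.* k)) * (cosh t (suc (2 ℕ.* k)) * f (n ℕ.∸ suc (2 ℕ.* k))) ≈ 0#
    odd-terms k = trans (*-congˡ (trans (*-congʳ (cosh-odd t k)) (zeroˡ _))) (zeroʳ _)

  module _ (s t : Carrier) where
    private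
      2[sx+ty] : ∀ x y → ι 2 * (s * x + t * y) ≈ s * (ι 2 * x) + t * (ι 2 * y)
      2[sx+ty] = solve 4 (λ s t x y → κ 2 :* (s :* x :+ t :* y) := s :* (κ 2 :* x) :+ t :* (κ 2 :* y)) refl s t

      step⁺ : ∀ {x y P M} → ι 2 * x ≈ P + M → ι 2 * y ≈ P - M →
              ι 2 * (s * x + t * y) ≈ (s + t) * P + (s - t) * M
      step⁺ {x} {y} {P} {M} 2x 2y = begin
        ι 2 * (s * x + t * y)          ≈⟨ 2[sx+ty] x y ⟩
        s * (ι 2 * x) + t * (ι 2 * y)  ≈⟨ +-cong (*-congˡ 2x) (*-congˡ 2y) ⟩
        s * (P + M) + t * (P - M)      ≈⟨ solve 4 (λ s t P M → s :* (P :+ M) :+ t :* (P :- M) := (s :+ t) :* P :+ (s :- t) :* M) refl s t P M ⟩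
        (s + t) * P + (s - t) * M      ∎

      step⁻ : ∀ {x y P M} → ι 2 * x ≈ P - M → ι 2 * y ≈ P + M →
              ι 2 * (s * x + t * y) ≈ (s + t) * P - (s - t) * M
      step⁻ {x} {y} {P} {M} 2x 2y = begin
        ι 2 * (s * x + t * y)          ≈⟨ 2[sx+ty] x y ⟩
        s * (ι 2 * x) + t * (ι 2 * y)  ≈⟨ +-cong (*-congˡ 2x) (*-congˡ 2y) ⟩
        s * (P - M) + t * (P + M)      ≈⟨ solve 4 (λ s t P M → s :* (P :- M) :+ t :* (P :+ M) := (s :+ t) :* P :- (s :- t) :* M) refl s t P M ⟩
        (s + t) * P - (s - t) * M      ∎

    -- Proved together, since differentiating each formula produces the others.
    product-formulas : ∀ n →
        (ι 2 * (cosh s ⋆ cosh t) n ≈ cosh (s + t) n + cosh (s - t) n)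
      × (ι 2 * (sinh s ⋆ sinh t) n ≈ cosh (s + t) n - cosh (s - t) n)
      × (ι 2 * (sinh s ⋆ cosh t) n ≈ sinh (s + t) n + sinh (s - t) n)
      × (ι 2 * (cosh s ⋆ sinh t) n ≈ sinh (s + t) n - sinh (s - t) n)
    product-formulas zero =
        solve 0 (κ 2 :* (κ 1 :* κ 1) := κ 1 :+ κ 1) refl
      , solve 0 (κ 2 :* (κ 0 :* κ 0) := κ 1 :- κ 1) refl
      , solve 0 (κ 2 :* (κ 0 :* κ 1) := κ 0 :+ κ 0) refl
      , solve 0 (κ 2 :* (κ 1 :* κ 0) := κ 0 :- κ 0) refl
    product-formulas (suc n) with product-formulas n
    ... | cc , ss , sc , cs =
        trans (*-congˡ (+-cong (⋆-scalarˡ s (sinh s) (cosh t) n) (⋆-scalarʳ t (cosh s) (sinh t) n))) (step⁺ sc cs)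
      , trans (*-congˡ (+-cong (⋆-scalarˡ s (cosh s) (sinh t) n) (⋆-scalarʳ t (sinh s) (cosh t) n))) (step⁻ cs sc)
      , trans (*-congˡ (+-cong (⋆-scalarˡ s (cosh s) (cosh t) n) (⋆-scalarʳ t (sinh s) (sinh t) n))) (step⁺ cc ss)
      , trans (*-congˡ (+-cong (⋆-scalarˡ s (sinh s) (sinh t) n) (⋆-scalarʳ t (cosh s) (cosh t) n))) (step⁻ ss cc)

  cosh-⋆-cosh : ∀ s t n → ι 2 * (cosh s ⋆ cosh t) n ≈ cosh (s + t) n + cosh (s - t) n
  cosh-⋆-cosh s t n = proj₁ (product-formulas s t n)

  2cosh²≈cosh2+δ : ∀ n → ι 2 * (cosh 1# ⋆ cosh 1#) n ≈ cosh (ι 2) n + δ n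
  2cosh²≈cosh2+δ n = trans (cosh-⋆-cosh 1# 1# n)
    (+-cong (cosh-cong 1+1≈2 n) (trans (cosh-cong (-‿inverseʳ 1#) n) (cosh-0# n)))
    where
    1+1≈2 : 1# + 1# ≈ ι 2
    1+1≈2 = solve 0 (κ 1 :+ κ 1 := κ 2) refl

  4cosh³≈cosh3+3cosh : ∀ n → ι 4 * ((cosh 1# ⋆ cosh 1#) ⋆ cosh 1#) n ≈ cosh (ι 3) n + ι 3 * cosh 1# n
  4cosh³≈cosh3+3cosh n = begin
    ι 4 * ((c ⋆ c) ⋆ c) n                          ≈⟨ trans (*-congʳ (ι-homo-* 2 2)) (*-assoc _ _ _) ⟩
    ι 2 * (ι 2 * ((c ⋆ c) ⋆ c) n)                  ≈⟨ *-congˡ (⋆-scalarˡ (ι 2) (c ⋆ c) c n) ⟨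
    ι 2 * ((λ k → ι 2 * (c ⋆ c) k) ⋆ c) n          ≈⟨ *-congˡ (⋆-cong 2cosh²≈cosh2+δ (λ _ → refl) n) ⟩
    ι 2 * ((λ k → cosh (ι 2) k + δ k) ⋆ c) n       ≈⟨ *-congˡ (⋆-distribʳ (cosh (ι 2)) δ c n) ⟩
    ι 2 * ((cosh (ι 2) ⋆ c) n + (δ ⋆ c) n)         ≈⟨ distribˡ _ _ _ ⟩
    ι 2 * (cosh (ι 2) ⋆ c) n + ι 2 * (δ ⋆ c) n     ≈⟨ +-cong (cosh-⋆-cosh (ι 2) 1# n) (*-congˡ (⋆-identityˡ c n)) ⟩
    (cosh (ι 2 + 1#) n + cosh (ι 2 - 1#) n) + ι 2 * c n
      ≈⟨ +-congʳ (+-cong (cosh-cong 2+1≈3 n) (cosh-cong 2-1≈1 n)) ⟩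
    (cosh (ι 3) n + c n) + ι 2 * c n               ≈⟨ solve 2 (λ x y → (x :+ y) :+ κ 2 :* y := x :+ κ 3 :* y) refl _ _ ⟩
    cosh (ι 3) n + ι 3 * c n                       ∎
    where
    c : Sequence
    c = cosh 1#
    2+1≈3 : ι 2 + 1# ≈ ι 3
    2+1≈3 = solve 0 (κ 2 :+ κ 1 := κ 3) refl
    2-1≈1 : ι 2 - 1# ≈ 1#
    2-1≈1 = solve 0 (κ 2 :- κ 1 := κ 1) refl

  module _ (a : Carrier) where
    Eₐ : Sequence
    Eₐ n = E R n a

    nth-Ehist : ∀ {n j} → j ≤ n → nth R (Ehist R a n) j ≡ Eₐ (n ℕ.∸ j)
    nth-Ehist {n}     {zero}  _         = ≡.refl
    nth-Ehist {suc n} {suc j} (s≤s j≤n) = nth-Ehist j≤n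

    E-recurrence : ∀ n → a * (cosh 1# ⋆ Eₐ) n ≈ δ n - (1# - a) * Eₐ n
    E-recurrence zero    =
      solve 1 (λ a → a :* (κ 1 :* κ 1) := κ 1 :- (κ 1 :- a) :* κ 1) refl a
    E-recurrence (suc n) = begin
      a * (cosh 1# ⋆ Eₐ) (suc n)               ≈⟨ *-congˡ (cosh-⋆ 1# Eₐ (suc n)) ⟩
      a * (ι 1 * (1# * Eₐ (suc n)) + Σ₁ R ⌊ suc n /2⌋ (λ k → ι (suc n C (2 ℕ.* k)) * (1# ^ (2 ℕ.* k) * Eₐ (suc n ℕ.∸ 2 ℕ.* k))))
        ≈⟨ *-congˡ (+-congˡ (Σ₁-cong ⌊ suc n /2⌋ term≈)) ⟩
      a * (ι 1 * (1# * (- a * W)) + W)         ≈⟨ solve 2 (λ a W → a :* ((κ 1 :+ κ 0) :* (κ 1 :* (:- a :* W)) :+ W) := κ 0 :- (κ 1 :- a) :* (:- a :* W)) refl a W ⟩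
      0# - (1# - a) * (- a * W)                ∎
      where
      -- Eₐ (suc n) is - a * W by definition.
      W : Carrier
      W = Σ₁ R ⌊ suc n /2⌋ (λ k → ι (suc n C (2 ℕ.* k)) * nth R (Ehist R a n) (2 ℕ.* k ℕ.∸ 1))
      term≈ : ∀ {k} → k ℕ.< ⌊ suc n /2⌋ →
              ι (suc n C (2 ℕ.* suc k)) * (1# ^ (2 ℕ.* suc k) * Eₐ (suc n ℕ.∸ 2 ℕ.* suc k))
                ≈ ι (suc n C (2 ℕ.* suc k)) * nth R (Ehist R a n) (2 ℕ.* suc k ℕ.∸ 1)
      term≈ {k} k< = *-congˡ (trans (*-congʳ (1#^n≈1# (2 ℕ.* suc k)))
        (trans (*-identityˡ _) (reflexive (≡.sym (nth-Ehist (ℕₚ.≤-pred (k≤⌊n/2⌋⇒2*k≤n k<)))))))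

    ⋆-E-recurrence : ∀ (X : Sequence) n → a * (X ⋆ (cosh 1# ⋆ Eₐ)) n ≈ X n - (1# - a) * (X ⋆ Eₐ) n
    ⋆-E-recurrence X n = begin
      a * (X ⋆ (cosh 1# ⋆ Eₐ)) n                      ≈⟨ ⋆-scalarʳ a X _ n ⟨
      (X ⋆ (λ k → a * (cosh 1# ⋆ Eₐ) k)) n            ≈⟨ ⋆-cong (λ _ → refl) (λ k → trans (E-recurrence k) (+-congˡ (-‿distribˡ-* _ _))) n ⟩
      (X ⋆ (λ k → δ k + - (1# - a) * Eₐ k)) n         ≈⟨ ⋆-distribˡ X δ _ n ⟩
      (X ⋆ δ) n + (X ⋆ (λ k → - (1# - a) * Eₐ k)) n   ≈⟨ +-cong (⋆-identityʳ X n) (⋆-scalarʳ _ X Eₐ n) ⟩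
      X n + - (1# - a) * (X ⋆ Eₐ) n                   ≈⟨ +-congˡ (-‿distribˡ-* _ _) ⟨
      X n - (1# - a) * (X ⋆ Eₐ) n                     ∎

    a³[cosh3⋆E]-even : ∀ m → let N = 2 ℕ.* suc m in
      a ^ 3 * (cosh (ι 3) ⋆ Eₐ) N
        ≈ ι 2 * a ^ 2 * ι 2 ^ N + ι 4 * a * (a - 1#) + (ι 3 * a ^ 2 * (1# - a) - ι 4 * (1# - a) ^ 3) * Eₐ N
    -- The two sides differ by a combination of the differences in h₁ … h₆, obtained by eliminating
    -- q, p and u in turn.
    a³[cosh3⋆E]-even m = x∙y⁻¹≈ε⇒x≈y _ _ (begin
      a ^ 3 * y - (ι 2 * a ^ 2 * w + ι 4 * a * (a - 1#) + (ι 3 * a ^ 2 * (1# - a) - ι 4 * (1# - a) ^ 3) * e)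
        ≈⟨ certificate a e u p q y P (c N) w ⟩
      - a ^ 3 * (ι 4 * q - (y + ι 3 * u)) + ι 4 * a ^ 2 * (a * q - (P - (1# - a) * p))
        + - (ι 4 * a * (1# - a)) * (a * p - (c N - (1# - a) * u))
        + (ι 4 * (1# - a) ^ 2 - ι 3 * a ^ 2) * (a * u - (0# - (1# - a) * e))
        + ι 2 * a ^ 2 * (ι 2 * P - w) + - (ι 4 * a * (1# - a)) * (c N - 1#)
        ≈⟨ difference≈0 _ h₄ +-zeros difference≈0 _ h₃ +-zeros difference≈0 _ h₂
             +-zeros difference≈0 _ h₁ +-zeros difference≈0 _ h₅ +-zeros difference≈0 _ h₆ ⟩
      0# ∎)
      where
      N : ℕ
      N = 2 ℕ.* suc m
      c : Sequence
      c = cosh 1#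
      e u p q y P w : Carrier
      e = Eₐ N
      u = (c ⋆ Eₐ) N
      p = (c ⋆ (c ⋆ Eₐ)) N
      q = ((c ⋆ c) ⋆ (c ⋆ Eₐ)) N
      y = (cosh (ι 3) ⋆ Eₐ) N
      P = (c ⋆ c) N
      w = ι 2 ^ N

      h₁ : a * u ≈ 0# - (1# - a) * e
      h₁ = E-recurrence N
      h₂ : a * p ≈ c N - (1# - a) * u
      h₂ = ⋆-E-recurrence c N
      h₃ : a * q ≈ P - (1# - a) * p
      h₃ = trans (⋆-E-recurrence (c ⋆ c) N) (+-congˡ (-‿cong (*-congˡ (⋆-assoc c c Eₐ N))))
      h₄ : ι 4 * q ≈ y + ι 3 * u
      h₄ = begin
        ι 4 * q                                             ≈⟨ *-congˡ (⋆-assoc (c ⋆ c) c Eₐ N) ⟨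
        ι 4 * (((c ⋆ c) ⋆ c) ⋆ Eₐ) N                        ≈⟨ ⋆-scalarˡ (ι 4) ((c ⋆ c) ⋆ c) Eₐ N ⟨
        ((λ k → ι 4 * ((c ⋆ c) ⋆ c) k) ⋆ Eₐ) N              ≈⟨ ⋆-cong 4cosh³≈cosh3+3cosh (λ _ → refl) N ⟩
        ((λ k → cosh (ι 3) k + ι 3 * c k) ⋆ Eₐ) N           ≈⟨ ⋆-distribʳ (cosh (ι 3)) (λ k → ι 3 * c k) Eₐ N ⟩
        y + ((λ k → ι 3 * c k) ⋆ Eₐ) N                      ≈⟨ +-congˡ (⋆-scalarˡ (ι 3) c Eₐ N) ⟩
        y + ι 3 * u                                         ∎
      h₅ : ι 2 * P ≈ w
      h₅ = trans (2cosh²≈cosh2+δ N) (trans (+-identityʳ _) (cosh-even (ι 2) (suc m)))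
      h₆ : c N ≈ 1#
      h₆ = trans (cosh-even 1# (suc m)) (1#^n≈1# N)

      certificate : ∀ a e u p q y P c w →
        a ^ 3 * y - (ι 2 * a ^ 2 * w + ι 4 * a * (a - 1#) + (ι 3 * a ^ 2 * (1# - a) - ι 4 * (1# - a) ^ 3) * e)
        ≈ - a ^ 3 * (ι 4 * q - (y + ι 3 * u)) + ι 4 * a ^ 2 * (a * q - (P - (1# - a) * p))
          + - (ι 4 * a * (1# - a)) * (a * p - (c - (1# - a) * u))
          + (ι 4 * (1# - a) ^ 2 - ι 3 * a ^ 2) * (a * u - (0# - (1# - a) * e))
          + ι 2 * a ^ 2 * (ι 2 * P - w) + - (ι 4 * a * (1# - a)) * (c - 1#)
      certificate = solve 9 (λ a e u p q y P c w →
        a :^ 3 :* y :- (κ 2 :* a :^ 2 :* w :+ κ 4 :* a :* (a :- κ 1) :+ (κ 3 :* a :^ 2 :* (κ 1 :- a) :- κ 4 :* (κ 1 :- a) :^ 3) :* e)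
        := :- a :^ 3 :* (κ 4 :* q :- (y :+ κ 3 :* u)) :+ κ 4 :* a :^ 2 :* (a :* q :- (P :- (κ 1 :- a) :* p))
          :+ :- (κ 4 :* a :* (κ 1 :- a)) :* (a :* p :- (c :- (κ 1 :- a) :* u))
          :+ (κ 4 :* (κ 1 :- a) :^ 2 :- κ 3 :* a :^ 2) :* (a :* u :- (κ 0 :- (κ 1 :- a) :* e))
          :+ κ 2 :* a :^ 2 :* (κ 2 :* P :- w) :+ :- (κ 4 :* a :* (κ 1 :- a)) :* (c :- κ 1)) refl

  divide-by-a³ : ∀ {a I e y L w Z} → a * I ≈ 1# → y ≈ ι 1 * (1# * e) + L →
    a ^ 3 * y ≈ ι 2 * a ^ 2 * w + ι 4 * a * (a - 1#) + (ι 3 * a ^ 2 * (1# - a) - ι 4 * (1# - a) ^ 3) * e →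
    Z ≈ ι 2 * w →
    L ≈ (Z * I + ι 4 * (a + - 1#) * I ^ 2) + - ((ι 3 * a + - ι 2) * (ι 3 * a + - ι 2) * I ^ 3 * e)
  divide-by-a³ {a} {I} {e} {y} {L} {w} {Z} aI≈1 y≈e+L a³y≈K Z≈2w = x∙y⁻¹≈ε⇒x≈y _ _ (begin
    L - ((Z * I + ι 4 * (a + - 1#) * I ^ 2) + - ((ι 3 * a + - ι 2) * (ι 3 * a + - ι 2) * I ^ 3 * e))
      ≈⟨ certificate a I e y L w Z ⟩
    - 1# * (y - (ι 1 * (1# * e) + L))
      + I ^ 3 * (a ^ 3 * y - (ι 2 * a ^ 2 * w + ι 4 * a * (a - 1#) + (ι 3 * a ^ 2 * (1# - a) - ι 4 * (1# - a) ^ 3) * e))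
      + (((a * I) ^ 2 + a * I + 1#) * (e - y) + ι 2 * w * I * (a * I + 1#) + ι 4 * (a - 1#) * I ^ 2) * (a * I - 1#)
      + - I * (Z - ι 2 * w)
      ≈⟨ difference≈0 _ y≈e+L +-zeros difference≈0 _ a³y≈K +-zeros difference≈0 _ aI≈1 +-zeros difference≈0 _ Z≈2w ⟩
    0# ∎)
    where
    -- The multiplier of a * I - 1# comes from factoring (a I)³ - 1 and (a I)² - 1.
    certificate : ∀ a I e y L w Z →
      L - ((Z * I + ι 4 * (a + - 1#) * I ^ 2) + - ((ι 3 * a + - ι 2) * (ι 3 * a + - ι 2) * I ^ 3 * e))
      ≈ - 1# * (y - (ι 1 * (1# * e) + L))
        + I ^ 3 * (a ^ 3 * y - (ι 2 * a ^ 2 * w + ι 4 * a * (a - 1#) + (ι 3 * a ^ 2 * (1# - a) - ι 4 * (1# - a) ^ 3) * e))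
        + (((a * I) ^ 2 + a * I + 1#) * (e - y) + ι 2 * w * I * (a * I + 1#) + ι 4 * (a - 1#) * I ^ 2) * (a * I - 1#)
        + - I * (Z - ι 2 * w)
    certificate = solve 7 (λ a I e y L w Z →
      L :- ((Z :* I :+ κ 4 :* (a :+ :- κ 1) :* I :^ 2) :+ :- ((κ 3 :* a :+ :- κ 2) :* (κ 3 :* a :+ :- κ 2) :* I :^ 3 :* e))
      := :- κ 1 :* (y :- ((κ 1 :+ κ 0) :* (κ 1 :* e) :+ L))
        :+ I :^ 3 :* (a :^ 3 :* y :- (κ 2 :* a :^ 2 :* w :+ κ 4 :* a :* (a :- κ 1) :+ (κ 3 :* a :^ 2 :* (κ 1 :- a) :- κ 4 :* (κ 1 :- a) :^ 3) :* e))
        :+ (((a :* I) :^ 2 :+ a :* I :+ κ 1) :* (e :- y) :+ κ 2 :* w :* I :* (a :* I :+ κ 1) :+ κ 4 :* (a :- κ 1) :* I :^ 2) :* (a :* I :- κ 1)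
        :+ :- I :* (Z :- κ 2 :* w)) refl

theorem2p4 : {c ℓ : Level} (R : CommutativeRing c ℓ) →
    let open CommutativeRing R in
    (a a⁻¹ : Carrier) → a * a⁻¹ ≈ 1# → (n : ℕ) → 1 ℕ.≤ n →
    Σ₁ R n (λ k → ⟦_⟧ R ((2 ℕ.* n) C (2 ℕ.* k)) * ((_^ᴿ_ R (⟦_⟧ R 3) (2 ℕ.* k)) * E R (2 ℕ.* n ℕ.∸ 2 ℕ.* k) a))
      ≈ ((⟦_⟧ R (2 ℕ.^ (2 ℕ.* n ℕ.+ 1)) * a⁻¹)
         + (⟦_⟧ R 4 * (a + - 1#)) * _^ᴿ_ R a⁻¹ 2)
         + - ((((⟦_⟧ R 3 * a) + - ⟦_⟧ R 2) * ((⟦_⟧ R 3 * a) + - ⟦_⟧ R 2)) * _^ᴿ_ R a⁻¹ 3 * E R (2 ℕ.* n) a)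
theorem2p4 R a a⁻¹ aa⁻¹≈1 (suc m) _ =
  divide-by-a³ aa⁻¹≈1 expansion (a³[cosh3⋆E]-even a m) ι-2^[N+1]
  where
  open CommutativeRing R
  open InCommutativeRing R
  N : ℕ
  N = 2 ℕ.* suc m
  F : Sequence
  F k = ι (N C (2 ℕ.* k)) * (ι 3 ^ (2 ℕ.* k) * Eₐ a (N ℕ.∸ 2 ℕ.* k))
  expansion : (cosh (ι 3) ⋆ Eₐ a) N ≈ ι 1 * (1# * Eₐ a N) + Σ₁ R (suc m) F
  expansion = trans (cosh-⋆ (ι 3) (Eₐ a) N) (reflexive (≡.cong (λ k → Σ₀ k F) (⌊2*n/2⌋≡n (suc m))))
  ι-2^[N+1] : ι (2 ℕ.^ (N ℕ.+ 1)) ≈ ι 2 * ι 2 ^ N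
  ι-2^[N+1] = trans (reflexive (≡.cong (λ k → ι (2 ℕ.^ k)) (ℕₚ.+-comm N 1))) (ι-homo-^ 2 (suc N))
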